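{- For any $h,i,j,k\ge 0$, the axiomatic extension of $\mathbf{SKt}$ with $G(h,i,j,k)$ is equivalent to the axiomatic extension of $\mathbf{SKt}$ with $P(h,i,j,k)$, where $G(h,i,j,k)$ is the Scott-Lemmon axiom scheme $\lozenge^h\square^i A\to\square^j\lozenge^k A$ and $P(h,i,j,k)$ is the primitive scheme $(\lozenge^{\bullet})^h\lozenge^j A\to\lozenge^i(\lozenge^{\bullet})^k A$.
   Context: Formulae are in negation normal form over $a,\neg a,\lor,\land,\square,\blacksquare,\lozenge,\lozenge^{\bullet}$, where $\lozenge^{\bullet}$ is the past diamond (dual of $\blacksquare$), $\overline A$ is the nnf of $\neg A$, $F\to G$ abbreviates $\overline F\lor G$, and $\lozenge^n A$ ($\square^n A$, etc.) denotes $A$ prefixed by $n$ copies of the operator. $\mathbf{SKt}$ is the shallow nested sequent calculus with rules $id$ ($\Gamma,a,\overline a$), $cut$, $\land$, $\lor$, $ctr$, $wk$, residuation $rf$ (from $\Gamma,\circ\{\Delta\}$ infer $\bullet\{\Gamma\},\Delta$) and $rp$ (from $\Gamma,\bullet\{\Delta\}$ infer $\circ\{\Gamma\},\Delta$), $\blacksquare$ (from $\Gamma,\bullet\{A\}$ infer $\Gamma,\blacksquare A$), $\square$ (from $\Gamma,\circ\{A\}$ infer $\Gamma,\square A$), $\lozenge^{\bullet}$ (from $\Gamma,\bullet\{\Delta,A\}$ infer $\Gamma,\bullet\{\Delta\},\lozenge^{\bullet}A$), $\lozenge$ (from $\Gamma,\circ\{\Delta,A\}$ infer $\Gamma,\circ\{\Delta\},\lozenge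 A$). The axiomatic extension of $\mathbf{SKt}$ with a set of axiom schemes $F\to G$ adds, for each, the premise-free rule with conclusion $\overline F, G$ (for all instances). -}

module Defs where

open import Data.Nat using (ℕ; zero; suc)
open import Data.List using (List; []; _∷_; _++_; [_])
open import Data.Product using (_×_; _,_; proj₁; proj₂)
open import Data.List.Relation.Binary.Permutation.Propositional using (_↭_)

-- Formulae in negation normal form; atoms are indexed by ℕ.
data Fml : Set where
  atm  : ℕ → Fml
  natm : ℕ → Fml
  _∨̇_  : Fml → Fml → Fml
  _∧̇_  : Fml → Fml → Fml
  □    : Fml → Fml        -- future box
  ■    : Fml → Fml        -- past box
  ◇    : Fml → Fml        -- future diamond
  ◆    : Fml → Fml        -- past diamond (dual of ■)

neg : Fml → Fml
neg (atm p)  = natm p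
neg (natm p) = atm p
neg (A ∨̇ B)  = neg A ∧̇ neg B
neg (A ∧̇ B)  = neg A ∨̇ neg B
neg (□ A)    = ◇ (neg A)
neg (■ A)    = ◆ (neg A)
neg (◇ A)    = □ (neg A)
neg (◆ A)    = ■ (neg A)

iter : ℕ → (Fml → Fml) → Fml → Fml
iter zero    op A = A
iter (suc n) op A = op (iter n op A)

-- Shallow nested sequents: lists (multisets, via the exchange rule) of
-- formulae and nested structures ∘{Δ} and •{Δ}.
data Item : Set where
  fm : Fml → Item
  wh : List Item → Item
  bl : List Item → Item

Seq : Set
Seq = List Item

-- An axiom scheme F(A) → G(A) in the metavariable A, given as the pair (F(A), G(A)).
Scheme : Set
Scheme = Fml → Fml × Fml

data Der (Ax : Scheme → Set) : Seq → Set where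
  ex   : ∀ {Γ Γ'} → Γ ↭ Γ' → Der Ax Γ → Der Ax Γ'
  id   : ∀ Γ p → Der Ax (Γ ++ fm (atm p) ∷ fm (natm p) ∷ [])
  cut  : ∀ Γ A → Der Ax (Γ ++ [ fm A ]) → Der Ax (Γ ++ [ fm (neg A) ]) → Der Ax Γ
  and  : ∀ Γ A B → Der Ax (Γ ++ [ fm A ]) → Der Ax (Γ ++ [ fm B ]) → Der Ax (Γ ++ [ fm (A ∧̇ B) ])
  or   : ∀ Γ A B → Der Ax (Γ ++ fm A ∷ fm B ∷ []) → Der Ax (Γ ++ [ fm (A ∨̇ B) ])
  ctr  : ∀ Γ Δ → Der Ax (Γ ++ Δ ++ Δ) → Der Ax (Γ ++ Δ)
  wk   : ∀ Γ Δ → Der Ax Γ → Der Ax (Γ ++ Δ)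
  rf   : ∀ Γ Δ → Der Ax (Γ ++ [ wh Δ ]) → Der Ax (bl Γ ∷ Δ)
  rp   : ∀ Γ Δ → Der Ax (Γ ++ [ bl Δ ]) → Der Ax (wh Γ ∷ Δ)
  ■r   : ∀ Γ A → Der Ax (Γ ++ [ bl [ fm A ] ]) → Der Ax (Γ ++ [ fm (■ A) ])
  □r   : ∀ Γ A → Der Ax (Γ ++ [ wh [ fm A ] ]) → Der Ax (Γ ++ [ fm (□ A) ])
  ◆r   : ∀ Γ Δ A → Der Ax (Γ ++ [ bl (Δ ++ [ fm A ]) ])
                 → Der Ax (Γ ++ bl Δ ∷ fm (◆ A) ∷ [])
  ◇r   : ∀ Γ Δ A → Der Ax (Γ ++ [ wh (Δ ++ [ fm A ]) ])
                 → Der Ax (Γ ++ wh Δ ∷ fm (◇ A) ∷ [])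
  ax   : ∀ S → Ax S → ∀ A → Der Ax (fm (neg (proj₁ (S A))) ∷ fm (proj₂ (S A)) ∷ [])

Only : Scheme → Scheme → Set
Only S S' = S' ≡S S
  where
  open import Relation.Binary.PropositionalEquality using () renaming (_≡_ to _≡S_)

Equivalent : (Scheme → Set) → (Scheme → Set) → Set
Equivalent X Y = ∀ Γ → ((Der X Γ → Der Y Γ) × (Der Y Γ → Der X Γ))

G : ℕ → ℕ → ℕ → ℕ → Scheme
G h i j k A = iter h ◇ (iter i □ A) , iter j □ (iter k ◇ A)

P : ℕ → ℕ → ℕ → ℕ → Scheme
P h i j k A = iter h ◆ (iter j ◇ A) , iter i ◇ (iter k ◆ A)

-- Read F ⇒ G as the two-formula sequent  ¬F, G.  Residuation makes ◆ left
-- adjoint to □ on such sequents, so ◆ᵏ □ᵏ C ⇒ C and B ⇒ □ᵏ ◆ᵏ B.  An instance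
-- ◆ʰ ◇ʲ B ⇒ ◇ⁱ ◆ᵏ B of P at B = □ᵏ C then yields, through the counit and the
-- adjunction, ◇ʲ □ᵏ C ⇒ □ʰ ◇ⁱ C, the contrapositive of G(h,i,j,k); conversely
-- that contrapositive at C = ◆ᵏ B, preceded by the unit, gives back P.  Since
-- each calculus derives every instance of the other's axiom, each simulates
-- the other.
module Submission where

open import Defs
open import Data.Nat using (ℕ; zero; suc)
open import Data.List using ([]; _∷_; [_])
open import Data.Product using (_,_; proj₁; proj₂)
open import Data.List.Relation.Binary.Permutation.Propositional
  using (_↭_; prep; swap; trans; ↭-refl)
open import Function using (_⇔_; mk⇔; Equivalence)
open import Relation.Binary.PropositionalEquality
  using (_≡_; refl; cong; cong₂; sym; subst; subst₂; module ≡-Reasoning)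

open Equivalence using (to; from)

neg-involutive : ∀ A → neg (neg A) ≡ A
neg-involutive (atm p)  = refl
neg-involutive (natm p) = refl
neg-involutive (A ∨̇ B)  = cong₂ _∨̇_ (neg-involutive A) (neg-involutive B)
neg-involutive (A ∧̇ B)  = cong₂ _∧̇_ (neg-involutive A) (neg-involutive B)
neg-involutive (□ A)    = cong □ (neg-involutive A)
neg-involutive (■ A)    = cong ■ (neg-involutive A)
neg-involutive (◇ A)    = cong ◇ (neg-involutive A)
neg-involutive (◆ A)    = cong ◆ (neg-involutive A)

iter-inner : ∀ n (f : Fml → Fml) A → iter n f (f A) ≡ f (iter n f A)
iter-inner zero    f A = refl
iter-inner (suc n) f A = cong f (iter-inner n f A)

neg-iter : ∀ {f g : Fml → Fml} → (∀ A → neg (f A) ≡ g (neg A)) →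
           ∀ n A → neg (iter n f A) ≡ iter n g (neg A)
neg-iter f-dual zero    A = refl
neg-iter {f} {g} f-dual (suc n) A = begin
  neg (f (iter n f A))   ≡⟨ f-dual (iter n f A) ⟩
  g (neg (iter n f A))   ≡⟨ cong g (neg-iter f-dual n A) ⟩
  g (iter n g (neg A))   ∎
  where open ≡-Reasoning

neg-iter-iter : ∀ {f g : Fml → Fml} →
                (∀ A → neg (f A) ≡ g (neg A)) → (∀ A → neg (g A) ≡ f (neg A)) →
                ∀ n m C → neg (iter n f (iter m g (neg C))) ≡ iter n g (iter m f C)
neg-iter-iter {f} {g} f-dual g-dual n m C = begin
  neg (iter n f (iter m g (neg C)))   ≡⟨ neg-iter f-dual n _ ⟩
  iter n g (neg (iter m g (neg C)))   ≡⟨ cong (iter n g) (neg-iter g-dual m _) ⟩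
  iter n g (iter m f (neg (neg C)))   ≡⟨ cong (λ X → iter n g (iter m f X)) (neg-involutive C) ⟩
  iter n g (iter m f C)               ∎
  where open ≡-Reasoning

swap₂₃ : ∀ {a b c : Item} → a ∷ b ∷ c ∷ [] ↭ a ∷ c ∷ b ∷ []
swap₂₃ = prep _ (swap _ _ ↭-refl)

rotate : ∀ {a b c : Item} → a ∷ b ∷ c ∷ [] ↭ c ∷ a ∷ b ∷ []
rotate = trans swap₂₃ (swap _ _ ↭-refl)

module _ {Ax : Scheme → Set} where

  exchange : ∀ {a b} → Der Ax (a ∷ b ∷ []) → Der Ax (b ∷ a ∷ [])
  exchange = ex (swap _ _ ↭-refl)

  -- rp (resp. rf) with an empty •{} (resp. ∘{}) acts as necessitation.
  □◇-step : ∀ {A B} → Der Ax (fm A ∷ fm B ∷ []) → Der Ax (fm (□ A) ∷ fm (◇ B) ∷ [])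
  □◇-step {A} {B} d =
    exchange (□r [ fm (◇ B) ] A (exchange (◇r [] [ fm A ] B (rp _ [] (wk _ [ bl [] ] d)))))

  ■◆-step : ∀ {A B} → Der Ax (fm A ∷ fm B ∷ []) → Der Ax (fm (■ A) ∷ fm (◆ B) ∷ [])
  ■◆-step {A} {B} d =
    exchange (■r [ fm (◆ B) ] A (exchange (◆r [] [ fm A ] B (rf _ [] (wk _ [ wh [] ] d)))))

  identity : ∀ A → Der Ax (fm A ∷ fm (neg A) ∷ [])
  identity (atm p)  = id [] p
  identity (natm p) = exchange (id [] p)
  identity (A ∨̇ B)  = and [ fm (A ∨̇ B) ] (neg A) (neg B) left right
    where
    left : Der Ax (fm (A ∨̇ B) ∷ fm (neg A) ∷ [])
    left = exchange (or [ fm (neg A) ] A B (wk _ [ fm B ] (exchange (identity A))))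
    right : Der Ax (fm (A ∨̇ B) ∷ fm (neg B) ∷ [])
    right = exchange (or [ fm (neg B) ] A B (ex swap₂₃ (wk _ [ fm A ] (exchange (identity B)))))
  identity (A ∧̇ B)  =
    or [ fm (A ∧̇ B) ] (neg A) (neg B) (ex rotate (and (fm (neg A) ∷ fm (neg B) ∷ []) A B left right))
    where
    left : Der Ax (fm (neg A) ∷ fm (neg B) ∷ fm A ∷ [])
    left = ex swap₂₃ (wk _ [ fm (neg B) ] (exchange (identity A)))
    right : Der Ax (fm (neg A) ∷ fm (neg B) ∷ fm B ∷ [])
    right = ex rotate (wk _ [ fm (neg A) ] (exchange (identity B)))
  identity (□ A)    = □◇-step (identity A)
  identity (■ A)    = ■◆-step (identity A)
  identity (◇ A)    = exchange (□◇-step (exchange (identity A)))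
  identity (◆ A)    = exchange (■◆-step (exchange (identity A)))

  □-inversion : ∀ {Y A} → Der Ax (fm Y ∷ fm (□ A) ∷ []) → Der Ax (fm Y ∷ wh [ fm A ] ∷ [])
  □-inversion {Y} {A} d = cut (fm Y ∷ wh [ fm A ] ∷ []) (□ A) (ex swap₂₃ (wk _ [ wh [ fm A ] ] d))
    (◇r [ fm Y ] [ fm A ] (neg A) (exchange (rp (fm A ∷ fm (neg A) ∷ []) [ fm Y ]
      (wk _ [ bl [ fm Y ] ] (identity A)))))

  ■-inversion : ∀ {Y A} → Der Ax (fm Y ∷ fm (■ A) ∷ []) → Der Ax (fm Y ∷ bl [ fm A ] ∷ [])
  ■-inversion {Y} {A} d = cut (fm Y ∷ bl [ fm A ] ∷ []) (■ A) (ex swap₂₃ (wk _ [ bl [ fm A ] ] d))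
    (◆r [ fm Y ] [ fm A ] (neg A) (exchange (rf (fm A ∷ fm (neg A) ∷ []) [ fm Y ]
      (wk _ [ wh [ fm Y ] ] (identity A)))))

infix 4 _⊢_⇒_ _⊢ₛ_

_⊢_⇒_ : (Scheme → Set) → Fml → Fml → Set
Ax ⊢ F ⇒ G = Der Ax (fm (neg F) ∷ fm G ∷ [])

_⊢ₛ_ : (Scheme → Set) → Scheme → Set
Ax ⊢ₛ S = ∀ A → Ax ⊢ proj₁ (S A) ⇒ proj₂ (S A)

Only-⊢ₛ : ∀ S → Only S ⊢ₛ S
Only-⊢ₛ S = ax S refl

Der-⊆ : ∀ {X Y : Scheme → Set} → (∀ S → X S → Y ⊢ₛ S) → ∀ {Γ} → Der X Γ → Der Y Γ
Der-⊆ f (ex p d)        = ex p (Der-⊆ f d)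
Der-⊆ f (id Γ p)        = id Γ p
Der-⊆ f (cut Γ A d e)   = cut Γ A (Der-⊆ f d) (Der-⊆ f e)
Der-⊆ f (and Γ A B d e) = and Γ A B (Der-⊆ f d) (Der-⊆ f e)
Der-⊆ f (or Γ A B d)    = or Γ A B (Der-⊆ f d)
Der-⊆ f (ctr Γ Δ d)     = ctr Γ Δ (Der-⊆ f d)
Der-⊆ f (wk Γ Δ d)      = wk Γ Δ (Der-⊆ f d)
Der-⊆ f (rf Γ Δ d)      = rf Γ Δ (Der-⊆ f d)
Der-⊆ f (rp Γ Δ d)      = rp Γ Δ (Der-⊆ f d)
Der-⊆ f (■r Γ A d)      = ■r Γ A (Der-⊆ f d)
Der-⊆ f (□r Γ A d)      = □r Γ A (Der-⊆ f d)
Der-⊆ f (◆r Γ Δ A d)    = ◆r Γ Δ A (Der-⊆ f d)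
Der-⊆ f (◇r Γ Δ A d)    = ◇r Γ Δ A (Der-⊆ f d)
Der-⊆ f (ax S p A)      = f S p A

module _ {Ax : Scheme → Set} where

  ⇒-refl : ∀ F → Ax ⊢ F ⇒ F
  ⇒-refl F = exchange (identity F)

  ⇒-trans : ∀ {F G H} → Ax ⊢ F ⇒ G → Ax ⊢ G ⇒ H → Ax ⊢ F ⇒ H
  ⇒-trans {F} {G} {H} d e = cut (fm (neg F) ∷ fm H ∷ []) G
    (ex swap₂₃ (wk _ [ fm H ] d)) (ex rotate (wk _ [ fm (neg F) ] (exchange e)))

  ⇒-contra : ∀ {F G} → Ax ⊢ F ⇒ G → Ax ⊢ neg G ⇒ neg F
  ⇒-contra {F} {G} d = subst (λ X → Der Ax (fm X ∷ fm (neg F) ∷ [])) (sym (neg-involutive G)) (exchange d)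

  ◇-mono : ∀ {F G} → Ax ⊢ F ⇒ G → Ax ⊢ ◇ F ⇒ ◇ G
  ◇-mono = □◇-step

  ◇ⁿ-mono : ∀ n {F G} → Ax ⊢ F ⇒ G → Ax ⊢ iter n ◇ F ⇒ iter n ◇ G
  ◇ⁿ-mono zero    d = d
  ◇ⁿ-mono (suc n) d = ◇-mono (◇ⁿ-mono n d)

  ◆⊣□ : ∀ {F Y} → (Ax ⊢ ◆ F ⇒ Y) ⇔ (Ax ⊢ F ⇒ □ Y)
  ◆⊣□ {F} {Y} = mk⇔
    (λ d → □r [ fm (neg F) ] Y (exchange (rp [ fm Y ] [ fm (neg F) ] (■-inversion (exchange d)))))
    (λ d → exchange (■r [ fm Y ] (neg F) (exchange (rf [ fm (neg F) ] [ fm Y ] (□-inversion d)))))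

  ◆ⁿ⊣□ⁿ : ∀ n {F Y} → (Ax ⊢ iter n ◆ F ⇒ Y) ⇔ (Ax ⊢ F ⇒ iter n □ Y)
  ◆ⁿ⊣□ⁿ zero    = mk⇔ (λ d → d) (λ d → d)
  ◆ⁿ⊣□ⁿ (suc n) {F} {Y} = mk⇔
    (λ d → subst (λ Z → Ax ⊢ F ⇒ Z) (iter-inner n □ Y) (to (◆ⁿ⊣□ⁿ n) (to ◆⊣□ d)))
    (λ d → from ◆⊣□ (from (◆ⁿ⊣□ⁿ n) (subst (λ Z → Ax ⊢ F ⇒ Z) (sym (iter-inner n □ Y)) d)))

  ◆ⁿ□ⁿ-counit : ∀ n C → Ax ⊢ iter n ◆ (iter n □ C) ⇒ C
  ◆ⁿ□ⁿ-counit n C = from (◆ⁿ⊣□ⁿ n) (⇒-refl (iter n □ C))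

  □ⁿ◆ⁿ-unit : ∀ n B → Ax ⊢ B ⇒ iter n □ (iter n ◆ B)
  □ⁿ◆ⁿ-unit n B = to (◆ⁿ⊣□ⁿ n) (⇒-refl (iter n ◆ B))

module _ {Ax : Scheme → Set} (h i j k : ℕ) where

  G-contrapose : Ax ⊢ₛ G h i j k → Ax ⊢ₛ G j k h i
  G-contrapose g C = subst₂ (Ax ⊢_⇒_)
    (neg-iter-iter (λ _ → refl) (λ _ → refl) j k C)
    (neg-iter-iter (λ _ → refl) (λ _ → refl) h i C)
    (⇒-contra (g (neg C)))

  P⇒G-contrapositive : Ax ⊢ₛ P h i j k → Ax ⊢ₛ G j k h i
  P⇒G-contrapositive p C =
    to (◆ⁿ⊣□ⁿ h) (⇒-trans (p (iter k □ C)) (◇ⁿ-mono i (◆ⁿ□ⁿ-counit k C)))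

  G-contrapositive⇒P : Ax ⊢ₛ G j k h i → Ax ⊢ₛ P h i j k
  G-contrapositive⇒P g B =
    from (◆ⁿ⊣□ⁿ h) (⇒-trans (◇ⁿ-mono j (□ⁿ◆ⁿ-unit k B)) (g (iter k ◆ B)))

lemma5p2 : (h i j k : ℕ) → Equivalent (Only (G h i j k)) (Only (P h i j k))
lemma5p2 h i j k Γ = Der-⊆ G-by-P , Der-⊆ P-by-G
  where
  G-by-P : ∀ S → Only (G h i j k) S → Only (P h i j k) ⊢ₛ S
  G-by-P _ refl = G-contrapose j k h i (P⇒G-contrapositive h i j k (Only-⊢ₛ (P h i j k)))
  P-by-G : ∀ S → Only (P h i j k) S → Only (G h i j k) ⊢ₛ S
  P-by-G _ refl = G-contrapositive⇒P h i j k (G-contrapose h i j k (Only-⊢ₛ (G h i j k)))
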